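{- Let $r\in\mathbb{Z}_{\geq 1}$ and let $T$ be a rooted tree whose root has branches (fringe subtrees rooted at the children of the root) $T^{1},\dots,T^{k}$, $k\ge 0$. Then \[ a_r(T) = \sum_{j=1}^{k} a_r(T^{j}) + f_r(T), \qquad f_r(T)=\begin{cases}1 & \text{if the height of } T \text{ is less than } r,\\ 0 & \text{otherwise.}\end{cases} \] That is, $a_r$ is an additive tree parameter with toll function $f_r(T)=[T\in\mathcal{T}_r]$, where $\mathcal{T}_r$ is the family of rooted trees of height less than $r$ and $[\cdot]$ is the Iverson bracket.
   Context: The "cutting leaves" reduction of a rooted tree removes all leaves (vertices without children) simultaneously; a tree consisting of a single vertex is removed entirely. For a rooted tree $T$ and $r\in\mathbb{Z}_{\ge1}$, $a_r(T)$ denotes the total number of vertices removed when this reduction is applied $r$ times to $T$. The height of a rooted tree is the greatest distance from the root to a leaf. A fringe subtree of a rooted tree is the subtree consisting of a vertex and all its descendants. An additive tree parameter is a functional $F$ with $F(T)=\sum_{j=1}^k F(T^j)+f(T)$ for a toll function $f$, where $T^1,\dots,T^k$ are the branches of the root. -}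

module Defs where

open import Data.Nat using (ℕ; zero; suc; _+_; _∸_; _⊔_; _<_)
open import Data.List using (List; []; _∷_)
open import Data.Maybe using (Maybe; just; nothing)
import Relation.Nullary
import Data.Nat

data Tree : Set where
  node : List Tree → Tree

branches : Tree → List Tree
branches (node ts) = ts

mutual
  size : Tree → ℕ
  size (node ts) = suc (sizes ts)

  sizes : List Tree → ℕ
  sizes [] = 0
  sizes (t ∷ ts) = size t + sizes ts

mutual
  height : Tree → ℕ
  height (node []) = 0
  height (node (t ∷ ts)) = suc (heights (t ∷ ts))

  heights : List Tree → ℕ
  heights [] = 0
  heights (t ∷ ts) = height t ⊔ heights ts

mutual
  -- one "cutting leaves" step: remove all leaves simultaneously;
  -- a single-vertex tree is removed entirely (result nothing).
  cut : Tree → Maybe Tree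
  cut (node []) = nothing
  cut (node (t ∷ ts)) = just (node (cuts (t ∷ ts)))

  cuts : List Tree → List Tree
  cuts [] = []
  cuts (t ∷ ts) with cut t
  ... | nothing = cuts ts
  ... | just t' = t' ∷ cuts ts

msize : Maybe Tree → ℕ
msize nothing = 0
msize (just t) = size t

cutIter : ℕ → Maybe Tree → Maybe Tree
cutIter zero m = m
cutIter (suc r) nothing = nothing
cutIter (suc r) (just t) = cutIter r (cut t)

a : ℕ → Tree → ℕ
a r T = size T ∸ msize (cutIter r (just T))

sumA : ℕ → List Tree → ℕ
sumA r [] = 0
sumA r (t ∷ ts) = a r t + sumA r ts

toll : ℕ → Tree → ℕ
toll r T with height T Data.Nat.<? r
... | Relation.Nullary.yes _ = 1
... | Relation.Nullary.no _ = 0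

-- A cut lowers the height of every fringe subtree by one, so after r cuts the
-- surviving vertices are exactly those whose fringe subtree has height at
-- least r. Hence a_r(T) counts the vertices whose fringe subtree has height
-- less than r, and that count splits at the root into the counts of the
-- branches plus the root's own indicator, which is the toll.
module Submission where

open import Defs
open import Data.Nat using (ℕ; zero; suc; _+_; _∸_; _⊔_; _≤_; z≤n; s≤s; _<?_)
open import Data.Nat.Properties
  using (⊔-identityʳ; ≤-pred; m+[n∸m]≡n; m+n∸n≡m; +-comm; +-commutativeSemigroup)
open import Algebra.Properties.CommutativeSemigroup +-commutativeSemigroup
  using () renaming (interchange to +-interchange)
open import Data.List using (List; []; _∷_)
open import Data.Maybe using (just; nothing)
open import Relation.Nullary using (yes; no; contradiction)
open import Relation.Binary.PropositionalEquality
  using (_≡_; refl; sym; trans; cong; cong₂; subst; module ≡-Reasoning)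

cutIter-nothing : ∀ r → cutIter r nothing ≡ nothing
cutIter-nothing zero    = refl
cutIter-nothing (suc r) = refl

height-∷ : ∀ t ts → height (node (t ∷ ts)) ≡ suc (height t) ⊔ height (node ts)
height-∷ t []      = cong suc (⊔-identityʳ (height t))
height-∷ t (_ ∷ _) = refl

-- For nonempty ts the right-hand side is height (node ts) ∸ 1.
height-cuts : ∀ ts → height (node (cuts ts)) ≡ heights ts
height-cuts []                   = refl
height-cuts (node []       ∷ ts) = height-cuts ts
height-cuts (node (u ∷ us) ∷ ts) = begin
  height (node (node (cuts (u ∷ us)) ∷ cuts ts))
    ≡⟨ height-∷ (node (cuts (u ∷ us))) (cuts ts) ⟩
  suc (height (node (cuts (u ∷ us)))) ⊔ height (node (cuts ts))
    ≡⟨ cong₂ (λ h h′ → suc h ⊔ h′) (height-cuts (u ∷ us)) (height-cuts ts) ⟩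
  suc (heights (u ∷ us)) ⊔ heights ts
    ∎
  where open ≡-Reasoning

toll≤1 : ∀ r T → toll r T ≤ 1
toll≤1 r T with height T <? r
... | yes _ = s≤s z≤n
... | no _  = z≤n

toll-suc : ∀ r {S T} → height T ≡ suc (height S) → toll (suc r) T ≡ toll r S
toll-suc r {S} {T} hT with height T <? suc r | height S <? r
... | yes _   | yes _   = refl
... | no  _   | no  _   = refl
... | yes T<r | no  S≮r = contradiction (≤-pred (subst (λ h → suc h ≤ suc r) hT T<r)) S≮r
... | no  T≮r | yes S<r = contradiction (subst (λ h → suc h ≤ suc r) (sym hT) (s≤s S<r)) T≮r

toll-zero : ∀ T → toll 0 T ≡ 0
toll-zero T with height T <? 0
... | no _ = refl

tall : ℕ → Tree → ℕ
tall r T = 1 ∸ toll r T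

mutual
  shortCount : ℕ → Tree → ℕ
  shortCount r (node ts) = toll r (node ts) + shortCounts r ts

  shortCounts : ℕ → List Tree → ℕ
  shortCounts r []       = 0
  shortCounts r (t ∷ ts) = shortCount r t + shortCounts r ts

mutual
  tallCount : ℕ → Tree → ℕ
  tallCount r (node ts) = tall r (node ts) + tallCounts r ts

  tallCounts : ℕ → List Tree → ℕ
  tallCounts r []       = 0
  tallCounts r (t ∷ ts) = tallCount r t + tallCounts r ts

mutual
  size≡short+tall : ∀ r T → size T ≡ shortCount r T + tallCount r T
  size≡short+tall r (node ts) = begin
    1 + sizes ts
      ≡⟨ cong₂ _+_ (sym (m+[n∸m]≡n (toll≤1 r (node ts)))) (sizes≡short+tall r ts) ⟩
    (toll r (node ts) + tall r (node ts)) + (shortCounts r ts + tallCounts r ts)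
      ≡⟨ +-interchange (toll r (node ts)) (tall r (node ts)) (shortCounts r ts) (tallCounts r ts) ⟩
    shortCount r (node ts) + tallCount r (node ts)
      ∎
    where open ≡-Reasoning

  sizes≡short+tall : ∀ r ts → sizes ts ≡ shortCounts r ts + tallCounts r ts
  sizes≡short+tall r []       = refl
  sizes≡short+tall r (t ∷ ts) =
    trans (cong₂ _+_ (size≡short+tall r t) (sizes≡short+tall r ts))
          (+-interchange (shortCount r t) (tallCount r t) (shortCounts r ts) (tallCounts r ts))

mutual
  tallCount-zero : ∀ T → tallCount 0 T ≡ size T
  tallCount-zero (node ts) = cong₂ _+_ (cong (1 ∸_) (toll-zero (node ts))) (tallCounts-zero ts)

  tallCounts-zero : ∀ ts → tallCounts 0 ts ≡ sizes ts
  tallCounts-zero []       = refl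
  tallCounts-zero (t ∷ ts) = cong₂ _+_ (tallCount-zero t) (tallCounts-zero ts)

tall-cut : ∀ r t ts → tall r (node (cuts (t ∷ ts))) ≡ tall (suc r) (node (t ∷ ts))
tall-cut r t ts = cong (1 ∸_) (sym (toll-suc r (cong suc (sym (height-cuts (t ∷ ts))))))

tallCounts-cuts : ∀ r ts → tallCounts r (cuts ts) ≡ tallCounts (suc r) ts
tallCounts-cuts r []                      = refl
tallCounts-cuts r (node []          ∷ ts) = tallCounts-cuts r ts
tallCounts-cuts r (node us@(u ∷ us′) ∷ ts) =
  cong₂ _+_ (cong₂ _+_ (tall-cut r u us′) (tallCounts-cuts r us)) (tallCounts-cuts r ts)

tallCount-cut : ∀ r t ts → tallCount r (node (cuts (t ∷ ts))) ≡ tallCount (suc r) (node (t ∷ ts))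
tallCount-cut r t ts = cong₂ _+_ (tall-cut r t ts) (tallCounts-cuts r (t ∷ ts))

msize-cutIter : ∀ r T → msize (cutIter r (just T)) ≡ tallCount r T
msize-cutIter zero    T               = sym (tallCount-zero T)
msize-cutIter (suc r) (node [])       = cong msize (cutIter-nothing r)
msize-cutIter (suc r) (node (u ∷ us)) =
  trans (msize-cutIter r (node (cuts (u ∷ us)))) (tallCount-cut r u us)

a≡shortCount : ∀ r T → a r T ≡ shortCount r T
a≡shortCount r T = begin
  size T ∸ msize (cutIter r (just T))            ≡⟨ cong₂ _∸_ (size≡short+tall r T) (msize-cutIter r T) ⟩
  shortCount r T + tallCount r T ∸ tallCount r T ≡⟨ m+n∸n≡m (shortCount r T) (tallCount r T) ⟩
  shortCount r T                                 ∎
  where open ≡-Reasoning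

sumA≡shortCounts : ∀ r ts → sumA r ts ≡ shortCounts r ts
sumA≡shortCounts r []       = refl
sumA≡shortCounts r (t ∷ ts) = cong₂ _+_ (a≡shortCount r t) (sumA≡shortCounts r ts)

proposition2p2 : (r : ℕ) → (ts : List Tree) →
    a (suc r) (node ts) ≡ sumA (suc r) ts + toll (suc r) (node ts)
proposition2p2 r ts = begin
  a (suc r) (node ts)                               ≡⟨ a≡shortCount (suc r) (node ts) ⟩
  toll (suc r) (node ts) + shortCounts (suc r) ts   ≡⟨ +-comm (toll (suc r) (node ts)) _ ⟩
  shortCounts (suc r) ts + toll (suc r) (node ts)   ≡⟨ cong (_+ toll (suc r) (node ts)) (sym (sumA≡shortCounts (suc r) ts)) ⟩
  sumA (suc r) ts + toll (suc r) (node ts)          ∎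
  where open ≡-Reasoning
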